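{- Let $G$ be a (not necessarily connected) graph of order $n\ge4$ and $\overline{G}$ its complement. Then $7\le\gamma_{qtR}(G)+\gamma_{qtR}(\overline{G})\le n+5$. Moreover: (i) $\gamma_{qtR}(G)+\gamma_{qtR}(\overline{G})=7$ if and only if $G$ and $\overline{G}$ belong to $\{K_4,\overline{K_4},K_4-e,\overline{K_4-e}\}\cup\mathcal{F}_1\cup\mathcal{F}'_1$; (ii) $\gamma_{qtR}(G)+\gamma_{qtR}(\overline{G})=n+5$ if and only if $G$ is the cycle $C_5$.
   Context: All graphs are finite, simple and undirected. $K_4-e$ is $K_4$ with one edge removed. $\mathcal{F}_1$ is the family of all graphs of order $n$ with maximum degree $n-1$ having exactly one vertex of degree $n-1$ and at least one vertex of degree one; $\mathcal{F}'_1$ is the family of complements of graphs in $\mathcal{F}_1$. For $f:V(G)\to\{0,1,2\}$ write $V_i=\{v:f(v)=i\}$, weight $\sum_v f(v)$. A quasi-total Roman dominating function (QTRDF) is a function $f:V(G)\to\{0,1,2\}$ such that every vertex $u$ with $f(u)=0$ is adjacent to some $v$ with $f(v)=2$, and every vertex $x$ that is isolated in the subgraph induced by $V_1\cup V_2$ satisfies $f(x)=1$. $\gamma_{qtR}(G)$ is the minimum weight of a QTRDF on $G$ (defined this way also for disconnected graphs). -}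

module Defs where

open import Data.Nat using (ℕ; zero; suc; _+_; _∸_; _≤_)
open import Data.Fin using (Fin; toℕ; _≟_)
open import Data.Fin.Patterns using (0F; 3F)
open import Data.Bool using (Bool; true; false; not; _∧_; _∨_; if_then_else_)
open import Data.Bool.Properties using (∨-comm)
open import Data.List using (List; map; allFin)
open import Data.Nat.ListAction using (sum)
open import Data.Product using (Σ; ∃; _×_; _,_)
open import Data.Sum using (_⊎_)
open import Function.Bundles using (_↔_; Inverse)
open import Relation.Nullary using (yes; no)
open import Relation.Nullary.Decidable using (⌊_⌋)
open import Relation.Binary.PropositionalEquality using (_≡_; refl; sym; cong₂)

record Graph (n : ℕ) : Set where
  field
    adj    : Fin n → Fin n → Bool
    adj-sym    : ∀ i j → adj i j ≡ adj j i
    adj-irrefl : ∀ i → adj i i ≡ false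
open Graph public

eqᵇ : ∀ {n} → Fin n → Fin n → Bool
eqᵇ i j = ⌊ i ≟ j ⌋

eqᵇ-sym : ∀ {n} (i j : Fin n) → eqᵇ i j ≡ eqᵇ j i
eqᵇ-sym i j with i ≟ j | j ≟ i
... | yes _ | yes _ = refl
... | no _  | no _  = refl
... | yes p | no ¬q = Data.Empty.⊥-elim (¬q (sym p)) where import Data.Empty
... | no ¬p | yes q = Data.Empty.⊥-elim (¬p (sym q)) where import Data.Empty

eqᵇ-refl : ∀ {n} (i : Fin n) → eqᵇ i i ≡ true
eqᵇ-refl i with i ≟ i
... | yes _ = refl
... | no ¬p = Data.Empty.⊥-elim (¬p refl) where import Data.Empty

mkGraph : ∀ {n} → (Fin n → Fin n → Bool) → Graph n
mkGraph r = record
  { adj = λ i j → (r i j ∨ r j i) ∧ not (eqᵇ i j)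
  ; adj-sym = λ i j → cong₂ (λ a b → a ∧ not b) (∨-comm (r i j) (r j i)) (eqᵇ-sym i j)
  ; adj-irrefl = λ i → lem (r i i ∨ r i i) (eqᵇ-refl i)
  }
  where
  lem : ∀ a {b} → b ≡ true → a ∧ not b ≡ false
  lem false refl = refl
  lem true  refl = refl

complement : ∀ {n} → Graph n → Graph n
complement G = mkGraph (λ i j → not (adj G i j))

deg : ∀ {n} → Graph n → Fin n → ℕ
deg {n} G v = sum (map (λ j → if adj G v j then 1 else 0) (allFin n))

weight : ∀ {n} → (Fin n → ℕ) → ℕ
weight {n} f = sum (map f (allFin n))

record IsQTRDF {n} (G : Graph n) (f : Fin n → ℕ) : Set where
  field
    range : ∀ v → f v ≤ 2
    dom   : ∀ u → f u ≡ 0 → ∃ λ v → adj G u v ≡ true × f v ≡ 2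
    -- every x isolated in G[V₁ ∪ V₂] has f(x)=1
    quasi : ∀ x → 1 ≤ f x → (∀ y → adj G x y ≡ true → f y ≡ 0) → f x ≡ 1

record IsγqtR {n} (G : Graph n) (k : ℕ) : Set where
  field
    witness : Σ (Fin n → ℕ) λ f → IsQTRDF G f × weight f ≡ k
    minimal : ∀ f → IsQTRDF G f → k ≤ weight f

_≅_ : ∀ {n m} → Graph n → Graph m → Set
_≅_ {n} {m} G H = Σ (Fin n ↔ Fin m) λ σ →
  ∀ i j → adj G i j ≡ adj H (Inverse.to σ i) (Inverse.to σ j)

K₄ : Graph 4
K₄ = mkGraph (λ _ _ → true)

K₄-e : Graph 4
K₄-e = mkGraph (λ i j → not ((eqᵇ i 0F ∧ eqᵇ j 3F) ∨ (eqᵇ i 3F ∧ eqᵇ j 0F)))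

C₅ : Graph 5
C₅ = mkGraph (λ i j → Data.Nat._≡ᵇ_ (toℕ j) (suc (toℕ i)) ∨
                      (Data.Nat._≡ᵇ_ (toℕ i) 4 ∧ Data.Nat._≡ᵇ_ (toℕ j) 0))
  where import Data.Nat

In𝓕₁ : ∀ {n} → Graph n → Set
In𝓕₁ {n} G =
  (∃ λ v → deg G v ≡ n ∸ 1 × (∀ w → deg G w ≡ n ∸ 1 → w ≡ v))
  × (∃ λ u → deg G u ≡ 1)

In𝓕₁′ : ∀ {n} → Graph n → Set
In𝓕₁′ {n} G = ∃ λ (H : Graph n) → In𝓕₁ H × G ≅ complement H

InFamily : ∀ {n} → Graph n → Set
InFamily G = G ≅ K₄ ⊎ G ≅ complement K₄ ⊎ G ≅ K₄-e ⊎ G ≅ complement K₄-e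
           ⊎ In𝓕₁ G ⊎ In𝓕₁′ G

-- Every QTRDF is either positive everywhere or puts 2 on a vertex with a positive neighbour, so
-- γqtR ≥ 3, with equality only if some vertex dominates G; that vertex is isolated in Ḡ, which forces
-- γqtR(Ḡ) ≥ 4. Hence the sum is at least 7, and analysing QTRDFs of weight 4 beside an isolated
-- vertex yields the extremal families.
-- For the upper bound, a vertex v with neighbours in both G and Ḡ carries a QTRDF of weight
-- n + 2 - deg v in G (2 on v, 1 on one neighbour and on every non-neighbour) and likewise in Ḡ, while
-- deg v + deg_Ḡ v = n - 1. If n + 5 is attained these bounds are tight at every vertex. Putting 2 on
-- both ends of an edge then shows that every neighbour of v has at most one neighbour outside N[v],
-- both in G and in Ḡ, and double counting the G-edges between N_G(v) and N_Ḡ(v) gives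
-- deg v = deg_Ḡ v = 2: G is 2-regular of order 5, i.e. C₅. The few graphs of order 4 and 5 involved,
-- and γqtR(C₅) = γqtR(C̄₅) = 5, are settled by exhaustive search.

module Submission where

open import Defs
open import Data.Nat using (ℕ; zero; suc; _+_; _*_; _∸_; _≤_; z≤n; s≤s; _≤?_)
import Data.Nat as ℕ
open import Data.Nat.Properties hiding (_≟_)
open import Data.Nat.Tactic.RingSolver using (solve-∀)
open import Data.Fin using (Fin; zero; suc; _≟_; toℕ; fromℕ<)
open import Data.Fin.Properties using (any?; all?; toℕ-fromℕ<)
open import Data.Fin.Patterns using (1F)
open import Data.Bool using (Bool; true; false; not; _∧_; _∨_; if_then_else_)
import Data.Bool.Properties as Boolₚ
open import Data.List using (List; []; _∷_; tabulate)
open import Data.List.Properties using (map-tabulate)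
import Data.Nat.ListAction as ListAction
open import Data.List.Relation.Unary.All using (All; []; _∷_)
open import Data.List.Relation.Unary.AllPairs using ([]; _∷_)
open import Data.List.Relation.Unary.Unique.Propositional using (Unique)
open import Data.List.Relation.Binary.Pointwise using (Pointwise; []; _∷_)
open import Data.Vec using (Vec; []; _∷_; lookup)
import Data.Vec as Vec
open import Data.Vec.Properties using (lookup∘tabulate)
open import Data.Unit using (⊤; tt)
open import Data.Product using (Σ; ∃; ∃₂; _×_; _,_; proj₁; proj₂)
open import Data.Sum using (_⊎_; inj₁; inj₂; [_,_]′)
import Data.Sum as Sum
open import Data.Empty using (⊥-elim)
open import Function using (_∘_; id)
open import Function.Bundles using (_⇔_; _↔_; Inverse; mk⇔; mk↔ₛ′)
open import Function.Construct.Symmetry using (↔-sym)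
open import Data.Fin.Permutation using (↔⇒≡)
open import Relation.Nullary using (Dec; yes; no; ¬?; contradiction)
open import Relation.Nullary.Decidable
  using (True; toSum; map′; _×-dec_; _⊎-dec_; _→-dec_; decidable-stable; toWitness)
open import Relation.Unary using (Decidable)
open import Relation.Binary.PropositionalEquality
  using (_≡_; _≢_; refl; sym; trans; cong; cong₂; subst; module ≡-Reasoning)
open import Algebra.Properties.Semiring.Sum +-*-semiring
  using (sum; sum-cong-≗; ∑-distrib-+; ∑-comm; sum-permute; *-distribˡ-sum; *-distribʳ-sum)

-- Finite sums

list-sum-tabulate : ∀ {n} (f : Fin n → ℕ) → ListAction.sum (tabulate f) ≡ sum f
list-sum-tabulate {zero} f = refl
list-sum-tabulate {suc n} f = cong (f zero +_) (list-sum-tabulate (f ∘ suc))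

weight≡sum : ∀ {n} (f : Fin n → ℕ) → weight f ≡ sum f
weight≡sum f = trans (cong ListAction.sum (map-tabulate id f)) (list-sum-tabulate f)

sum-mono-≤ : ∀ {n} {f g : Fin n → ℕ} → (∀ x → f x ≤ g x) → sum f ≤ sum g
sum-mono-≤ {zero} _ = z≤n
sum-mono-≤ {suc n} f≤g = +-mono-≤ (f≤g zero) (sum-mono-≤ (f≤g ∘ suc))

sum-const : ∀ n c → sum {n} (λ _ → c) ≡ n * c
sum-const zero c = refl
sum-const (suc n) c = cong (c +_) (sum-const n c)

sum-zero : ∀ n → sum {n} (λ _ → 0) ≡ 0
sum-zero n = trans (sum-const n 0) (*-zeroʳ n)

sum-one : ∀ n → sum {n} (λ _ → 1) ≡ n
sum-one n = trans (sum-const n 1) (*-identityʳ n)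

𝟙 : Bool → ℕ
𝟙 b = if b then 1 else 0

𝟙≤1 : ∀ b → 𝟙 b ≤ 1
𝟙≤1 true = ≤-refl
𝟙≤1 false = z≤n

𝟙-not+𝟙 : ∀ b → 𝟙 (not b) + 𝟙 b ≡ 1
𝟙-not+𝟙 true = refl
𝟙-not+𝟙 false = refl

𝟙-split : ∀ p q → 𝟙 p ≡ 𝟙 (p ∧ q) + 𝟙 (p ∧ not q)
𝟙-split true true = refl
𝟙-split true false = refl
𝟙-split false q = refl

𝟙≡0⇒false : ∀ {b} → 𝟙 b ≡ 0 → b ≡ false
𝟙≡0⇒false {false} _ = refl

∧≡true : ∀ {p q} → p ∧ q ≡ true → p ≡ true × q ≡ true
∧≡true {true} {true} _ = refl , refl

eqᵇ-≢ : ∀ {n} {x v : Fin n} → x ≢ v → eqᵇ x v ≡ false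
eqᵇ-≢ {x = x} {v} x≢v with x ≟ v
... | yes x≡v = ⊥-elim (x≢v x≡v)
... | no _ = refl

eqᵇ-suc : ∀ {n} (x v : Fin n) → eqᵇ (suc x) (suc v) ≡ eqᵇ x v
eqᵇ-suc x v with x ≟ v
... | yes _ = refl
... | no _ = refl

δ : ∀ {n} → Fin n → Fin n → ℕ
δ v x = 𝟙 (eqᵇ x v)

δ-self : ∀ {n} (v : Fin n) → δ v v ≡ 1
δ-self v = cong 𝟙 (eqᵇ-refl v)

δ-other : ∀ {n} {v x : Fin n} → x ≢ v → δ v x ≡ 0
δ-other x≢v = cong 𝟙 (eqᵇ-≢ x≢v)

sum-δ : ∀ {n} (v : Fin n) → sum (δ v) ≡ 1
sum-δ {suc n} zero = cong suc (sum-zero n)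
sum-δ {suc n} (suc v) = trans (sum-cong-≗ (λ x → cong 𝟙 (eqᵇ-suc x v))) (sum-δ v)

erase : ∀ {n} → Fin n → (Fin n → ℕ) → Fin n → ℕ
erase v f x = if eqᵇ x v then 0 else f x

erase-other : ∀ {n} {v x : Fin n} (f : Fin n → ℕ) → x ≢ v → erase v f x ≡ f x
erase-other {x = x} f x≢v = cong (λ b → if b then 0 else f x) (eqᵇ-≢ x≢v)

sum-erase : ∀ {n} (v : Fin n) (f : Fin n → ℕ) → sum f ≡ f v + sum (erase v f)
sum-erase v f = begin
  sum f                                      ≡⟨ sum-cong-≗ split ⟩
  sum (λ x → δ v x * f v + erase v f x)      ≡⟨ ∑-distrib-+ (λ x → δ v x * f v) (erase v f) ⟩
  sum (λ x → δ v x * f v) + sum (erase v f)  ≡⟨ cong (_+ sum (erase v f)) (*-distribʳ-sum (f v) (δ v)) ⟨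
  sum (δ v) * f v + sum (erase v f)          ≡⟨ cong (λ s → s * f v + sum (erase v f)) (sum-δ v) ⟩
  1 * f v + sum (erase v f)                  ≡⟨ cong (_+ sum (erase v f)) (*-identityˡ (f v)) ⟩
  f v + sum (erase v f)                      ∎
  where
  open ≡-Reasoning
  split : ∀ x → f x ≡ δ v x * f v + erase v f x
  split x with x ≟ v
  ... | yes refl = sym (trans (+-identityʳ (1 * f x)) (*-identityˡ (f x)))
  ... | no _ = refl

bounds≤sum : ∀ {n} (f : Fin n → ℕ) {xs : List (Fin n)} {ℓs : List ℕ} →
       Unique xs → Pointwise (λ x ℓ → ℓ ≤ f x) xs ℓs → ListAction.sum ℓs ≤ sum f
bounds≤sum f [] [] = z≤n
bounds≤sum f {x ∷ xs} {ℓ ∷ ℓs} (x∉xs ∷ unique) (ℓ≤fx ∷ bounds) = begin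
  ℓ + ListAction.sum ℓs  ≤⟨ +-mono-≤ ℓ≤fx (bounds≤sum (erase x f) unique (erased x∉xs bounds)) ⟩
  f x + sum (erase x f)  ≡⟨ sum-erase x f ⟨
  sum f                  ∎
  where
  open ≤-Reasoning
  erased : ∀ {ys ms} → All (x ≢_) ys → Pointwise (λ y m → m ≤ f y) ys ms →
           Pointwise (λ y m → m ≤ erase x f y) ys ms
  erased [] [] = []
  erased (x≢y ∷ ne) (m≤fy ∷ ps) =
    subst (_ ≤_) (sym (erase-other f (x≢y ∘ sym))) m≤fy ∷ erased ne ps

sum-𝟙≤1 : ∀ {n} (P : Fin n → Bool) → (∀ x y → P x ≡ true → P y ≡ true → x ≡ y) →
          sum (𝟙 ∘ P) ≤ 1
sum-𝟙≤1 {n} P unique with any? (λ x → P x Boolₚ.≟ true)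
... | yes (x₀ , Px₀) = ≤-trans (sum-mono-≤ bound) (≤-reflexive (sum-δ x₀))
  where
  bound : ∀ y → 𝟙 (P y) ≤ δ x₀ y
  bound y with P y in Py
  ... | false = z≤n
  ... | true rewrite unique y x₀ Py Px₀ = ≤-reflexive (sym (δ-self x₀))
... | no ¬P = ≤-trans (≤-reflexive (trans (sum-cong-≗ none) (sum-zero n))) z≤n
  where
  none : ∀ y → 𝟙 (P y) ≡ 0
  none y with P y in Py
  ... | false = refl
  ... | true = ⊥-elim (¬P (y , Py))

-- Adjacency, complements and degrees

false≢true : false ≢ true
false≢true ()

adj⇒≢ : ∀ {n} (G : Graph n) {x y} → adj G x y ≡ true → x ≢ y
adj⇒≢ G {x} xy refl = false≢true (trans (sym (adj-irrefl G x)) xy)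

adj-complement : ∀ {n} (G : Graph n) i j → adj (complement G) i j ≡ not (adj G i j) ∧ not (eqᵇ i j)
adj-complement G i j = trans (cong (λ b → (not (adj G i j) ∨ not b) ∧ not (eqᵇ i j)) (adj-sym G j i))
                             (cong (_∧ not (eqᵇ i j)) (Boolₚ.∨-idem (not (adj G i j))))

adj⇒¬adj-complement : ∀ {n} (G : Graph n) {x y} → adj G x y ≡ true → adj (complement G) x y ≡ false
adj⇒¬adj-complement G {x} {y} xy = trans (adj-complement G x y) (cong (λ b → not b ∧ not (eqᵇ x y)) xy)

¬adj⇒adj-complement : ∀ {n} (G : Graph n) {x y} → adj G x y ≡ false → x ≢ y →
                      adj (complement G) x y ≡ true
¬adj⇒adj-complement G {x} {y} ¬xy x≢y =
  trans (adj-complement G x y) (cong₂ (λ b c → not b ∧ not c) ¬xy (eqᵇ-≢ x≢y))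

adj-complement⇒¬adj : ∀ {n} (G : Graph n) {x y} → adj (complement G) x y ≡ true → adj G x y ≡ false
adj-complement⇒¬adj G x̄y = Boolₚ.¬-not (λ xy → false≢true (trans (sym (adj⇒¬adj-complement G xy)) x̄y))

_≈ᴳ_ : ∀ {n} → Graph n → Graph n → Set
G ≈ᴳ H = ∀ i j → adj G i j ≡ adj H i j

complement-involutive : ∀ {n} (G : Graph n) → complement (complement G) ≈ᴳ G
complement-involutive G i j rewrite adj-complement (complement G) i j | adj-complement G i j with i ≟ j
... | yes refl rewrite adj-irrefl G i = refl
... | no i≢j with adj G i j
...   | true = refl
...   | false = refl

≈ᴳ-complement² : ∀ {n} (G : Graph n) → G ≈ᴳ complement (complement G)
≈ᴳ-complement² G i j = sym (complement-involutive G i j)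

Dominating : ∀ {n} → Graph n → Fin n → Set
Dominating G v = ∀ x → x ≢ v → adj G v x ≡ true

Isolated : ∀ {n} → Graph n → Fin n → Set
Isolated G v = ∀ x → adj G v x ≡ false

isolated⊎neighbour : ∀ {n} (G : Graph n) v → Isolated G v ⊎ ∃ λ x → adj G v x ≡ true
isolated⊎neighbour G v with any? (λ x → adj G v x Boolₚ.≟ true)
... | yes neighbour = inj₂ neighbour
... | no ¬neighbour = inj₁ (λ x → Boolₚ.¬-not (λ vx → ¬neighbour (x , vx)))

dominating⇒isolated-complement : ∀ {n} (G : Graph n) {v} → Dominating G v → Isolated (complement G) v
dominating⇒isolated-complement G {v} dom x with toSum (x ≟ v)
... | inj₁ refl = adj-irrefl (complement G) x
... | inj₂ x≢v = adj⇒¬adj-complement G (dom x x≢v)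

isolated⇒dominating-complement : ∀ {n} (G : Graph n) {v} → Isolated G v → Dominating (complement G) v
isolated⇒dominating-complement G iso x x≢v = ¬adj⇒adj-complement G (iso x) (x≢v ∘ sym)

isolated-complement⇒dominating : ∀ {n} (G : Graph n) {v} → Isolated (complement G) v → Dominating G v
isolated-complement⇒dominating G {v} iso x x≢v with adj G v x in vx
... | true = refl
... | false = ⊥-elim (false≢true (trans (sym (iso x)) (¬adj⇒adj-complement G vx (x≢v ∘ sym))))

another-vertex : ∀ {n} → 2 ≤ n → (v : Fin n) → ∃ λ x → x ≢ v
another-vertex (s≤s (s≤s _)) zero = suc zero , λ ()
another-vertex (s≤s (s≤s _)) (suc v) = zero , λ ()

deg≡sum : ∀ {n} (G : Graph n) v → deg G v ≡ sum (𝟙 ∘ adj G v)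
deg≡sum G v = weight≡sum (𝟙 ∘ adj G v)

deg-resp-≈ᴳ : ∀ {n} {G H : Graph n} → G ≈ᴳ H → ∀ v → deg G v ≡ deg H v
deg-resp-≈ᴳ {G = G} {H} G≈H v =
  trans (deg≡sum G v) (trans (sum-cong-≗ (cong 𝟙 ∘ G≈H v)) (sym (deg≡sum H v)))

sum-nonadj+deg : ∀ {n} (G : Graph n) v → sum (𝟙 ∘ not ∘ adj G v) + deg G v ≡ n
sum-nonadj+deg {n} G v = begin
  sum (𝟙 ∘ not ∘ adj G v) + deg G v                ≡⟨ cong (sum (𝟙 ∘ not ∘ adj G v) +_) (deg≡sum G v) ⟩
  sum (𝟙 ∘ not ∘ adj G v) + sum (𝟙 ∘ adj G v)      ≡⟨ ∑-distrib-+ (𝟙 ∘ not ∘ adj G v) (𝟙 ∘ adj G v) ⟨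
  sum (λ x → 𝟙 (not (adj G v x)) + 𝟙 (adj G v x))  ≡⟨ sum-cong-≗ (λ x → 𝟙-not+𝟙 (adj G v x)) ⟩
  sum {n} (λ _ → 1)                                ≡⟨ sum-one n ⟩
  n                                                ∎
  where open ≡-Reasoning

deg-complement : ∀ {n} (G : Graph n) v → deg G v + deg (complement G) v + 1 ≡ n
deg-complement {n} G v = begin
  deg G v + deg Ḡ v + 1              ≡⟨ cong₂ (λ p q → p + q + 1) (deg≡sum G v) (deg≡sum Ḡ v) ⟩
  sum A + sum B + 1                  ≡⟨ cong (sum A + sum B +_) (sum-δ v) ⟨
  sum A + sum B + sum (δ v)          ≡⟨ cong (_+ sum (δ v)) (∑-distrib-+ A B) ⟨
  sum (λ x → A x + B x) + sum (δ v)  ≡⟨ ∑-distrib-+ (λ x → A x + B x) (δ v) ⟨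
  sum (λ x → A x + B x + δ v x)      ≡⟨ sum-cong-≗ one ⟩
  sum {n} (λ _ → 1)                  ≡⟨ sum-one n ⟩
  n                                  ∎
  where
  open ≡-Reasoning
  Ḡ : Graph n
  Ḡ = complement G
  A : Fin n → ℕ
  A = 𝟙 ∘ adj G v
  B : Fin n → ℕ
  B = 𝟙 ∘ adj Ḡ v
  one : ∀ x → A x + B x + δ v x ≡ 1
  one x with x ≟ v
  ... | yes refl rewrite adj-irrefl Ḡ x | adj-irrefl G x = refl
  ... | no x≢v rewrite adj-complement G v x | eqᵇ-≢ (x≢v ∘ sym) with adj G v x
  ...   | true = refl
  ...   | false = refl

neighbour⇒1≤deg : ∀ {n} (G : Graph n) {v x} → adj G v x ≡ true → 1 ≤ deg G v
neighbour⇒1≤deg G {v} vx =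
  subst (1 ≤_) (sym (deg≡sum G v))
        (bounds≤sum (𝟙 ∘ adj G v) ([] ∷ []) (≤-reflexive (cong 𝟙 (sym vx)) ∷ []))

two-neighbours⇒2≤deg : ∀ {n} (G : Graph n) {v x y} → adj G v x ≡ true → adj G v y ≡ true → x ≢ y →
                       2 ≤ deg G v
two-neighbours⇒2≤deg G {v} vx vy x≢y =
  subst (2 ≤_) (sym (deg≡sum G v))
        (bounds≤sum (𝟙 ∘ adj G v) ((x≢y ∷ []) ∷ [] ∷ [])
                    (≤-reflexive (cong 𝟙 (sym vx)) ∷ ≤-reflexive (cong 𝟙 (sym vy)) ∷ []))

isolated⇒deg≡0 : ∀ {n} (G : Graph n) {v} → Isolated G v → deg G v ≡ 0
isolated⇒deg≡0 {n} G {v} iso = trans (deg≡sum G v) (trans (sum-cong-≗ (cong 𝟙 ∘ iso)) (sum-zero n))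

deg≡0⇒isolated : ∀ {n} (G : Graph n) {v} → deg G v ≡ 0 → Isolated G v
deg≡0⇒isolated G {v} d≡0 x =
  Boolₚ.¬-not (λ vx → contradiction (subst (1 ≤_) d≡0 (neighbour⇒1≤deg G vx)) λ ())

dominating⇒deg : ∀ {n} (G : Graph n) {v} → Dominating G v → deg G v + 1 ≡ n
dominating⇒deg {n} G {v} dom = begin
  deg G v + 1                         ≡⟨ cong (_+ 1) (+-identityʳ (deg G v)) ⟨
  deg G v + 0 + 1                     ≡⟨ cong (λ d → deg G v + d + 1) deg-complement≡0 ⟨
  deg G v + deg (complement G) v + 1  ≡⟨ deg-complement G v ⟩
  n                                   ∎
  where
  open ≡-Reasoning
  deg-complement≡0 : deg (complement G) v ≡ 0
  deg-complement≡0 = isolated⇒deg≡0 (complement G) (dominating⇒isolated-complement G dom)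

deg≡n∸1⇒dominating : ∀ {n} (G : Graph n) {v} → 1 ≤ n → deg G v ≡ n ∸ 1 → Dominating G v
deg≡n∸1⇒dominating {n} G {v} 1≤n d≡n∸1 =
  isolated-complement⇒dominating G
    (deg≡0⇒isolated (complement G) (+-cancelˡ-≡ (deg G v) _ _ (+-cancelʳ-≡ 1 _ _ sums)))
  where
  sums : deg G v + deg (complement G) v + 1 ≡ deg G v + 0 + 1
  sums = begin
    deg G v + deg (complement G) v + 1  ≡⟨ deg-complement G v ⟩
    n                                   ≡⟨ m∸n+n≡m 1≤n ⟨
    n ∸ 1 + 1                           ≡⟨ cong (_+ 1) (trans (+-identityʳ (deg G v)) d≡n∸1) ⟨
    deg G v + 0 + 1                     ∎
    where open ≡-Reasoning

-- Quasi-total Roman dominating functions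

γ≤ : ∀ {n} {G : Graph n} {a f} → IsγqtR G a → IsQTRDF G f → a ≤ sum f
γ≤ {f = f} γ q = subst (_ ≤_) (weight≡sum f) (IsγqtR.minimal γ f q)

γ-attained : ∀ {n} {G : Graph n} {a} → IsγqtR G a → ∃ λ f → IsQTRDF G f × sum f ≡ a
γ-attained γ with IsγqtR.witness γ
... | f , q , w = f , q , trans (sym (weight≡sum f)) w

≤γ : ∀ {n} {G : Graph n} {a k} → (∀ f → IsQTRDF G f → k ≤ sum f) → IsγqtR G a → k ≤ a
≤γ bound γ with γ-attained γ
... | f , q , w = subst (_ ≤_) w (bound f q)

positive⇒n≤sum : ∀ {n} {f : Fin n → ℕ} → (∀ x → 1 ≤ f x) → n ≤ sum f
positive⇒n≤sum {n} {f} pos = subst (_≤ sum f) (sum-one n) (sum-mono-≤ pos)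

qtrdf-shape : ∀ {n} {G : Graph n} {f} → IsQTRDF G f →
              (∀ x → 1 ≤ f x) ⊎ ∃₂ λ z y → f z ≡ 2 × adj G z y ≡ true × 1 ≤ f y
qtrdf-shape {G = G} {f} q with any? (λ x → f x ℕ.≟ 0)
... | no ¬zero = inj₁ (λ x → n≢0⇒n>0 (λ fx≡0 → ¬zero (x , fx≡0)))
... | yes (x , fx≡0) with IsQTRDF.dom q x fx≡0
...   | z , _ , fz≡2 with any? (λ y → (adj G z y Boolₚ.≟ true) ×-dec ¬? (f y ℕ.≟ 0))
...     | yes (y , zy , fy≢0) = inj₂ (z , y , fz≡2 , zy , n≢0⇒n>0 fy≢0)
...     | no ¬positive = contradiction (IsQTRDF.quasi q z (subst (1 ≤_) (sym fz≡2) (s≤s z≤n)) alone)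
                                       (λ fz≡1 → contradiction (trans (sym fz≡1) fz≡2) λ ())
  where
  alone : ∀ y → adj G z y ≡ true → f y ≡ 0
  alone y zy = decidable-stable (f y ℕ.≟ 0) (λ fy≢0 → ¬positive (y , zy , fy≢0))

isolated⇒positive : ∀ {n} {G : Graph n} {f v} → IsQTRDF G f → Isolated G v → 1 ≤ f v
isolated⇒positive {G = G} {f} {v} q iso with f v ℕ.≟ 0
... | no fv≢0 = n≢0⇒n>0 fv≢0
... | yes fv≡0 with IsQTRDF.dom q v fv≡0
...   | t , vt , _ = ⊥-elim (false≢true (trans (sym (iso t)) vt))

weight≥3 : ∀ {n} {G : Graph n} {f} → 3 ≤ n → IsQTRDF G f → 3 ≤ sum f
weight≥3 {G = G} {f} 3≤n q with qtrdf-shape q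
... | inj₁ positive = ≤-trans 3≤n (positive⇒n≤sum positive)
... | inj₂ (z , y , fz≡2 , zy , 1≤fy) =
  bounds≤sum f ((adj⇒≢ G zy ∷ []) ∷ [] ∷ []) (≤-reflexive (sym fz≡2) ∷ 1≤fy ∷ [])

3≤γ : ∀ {n} {G : Graph n} {a} → 3 ≤ n → IsγqtR G a → 3 ≤ a
3≤γ 3≤n = ≤γ (λ _ → weight≥3 3≤n)

isolated∉edge : ∀ {n} (G : Graph n) {v z y} → Isolated G v → adj G z y ≡ true → v ≢ z × v ≢ y
isolated∉edge G iso zy = (λ { refl → false≢true (trans (sym (iso _)) zy) })
                       , (λ { refl → false≢true (trans (sym (iso _)) (trans (adj-sym G _ _) zy)) })

isolated⇒weight≥4 : ∀ {n} {G : Graph n} {f v} → 4 ≤ n → Isolated G v → IsQTRDF G f → 4 ≤ sum f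
isolated⇒weight≥4 {G = G} {f} {v} 4≤n iso q with qtrdf-shape q
... | inj₁ positive = ≤-trans 4≤n (positive⇒n≤sum positive)
... | inj₂ (z , y , fz≡2 , zy , 1≤fy) =
  let v≢z , v≢y = isolated∉edge G iso zy in
  bounds≤sum f ((v≢z ∷ v≢y ∷ []) ∷ (adj⇒≢ G zy ∷ []) ∷ [] ∷ [])
         (isolated⇒positive q iso ∷ ≤-reflexive (sym fz≡2) ∷ 1≤fy ∷ [])

weight≡3⇒dominating : ∀ {n} {G : Graph n} {f} → 4 ≤ n → IsQTRDF G f → sum f ≡ 3 → ∃ (Dominating G)
weight≡3⇒dominating {G = G} {f} 4≤n q w≡3 with qtrdf-shape q
... | inj₁ positive = contradiction (≤-trans 4≤n (positive⇒n≤sum positive)) (<-irrefl (sym w≡3))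
... | inj₂ (z , y , fz≡2 , zy , 1≤fy) = z , dominating
  where
  only-z-has-value-2 : ∀ t → f t ≡ 2 → t ≡ z
  only-z-has-value-2 t ft≡2 = decidable-stable (t ≟ z) λ t≢z →
    <-irrefl (sym w≡3)
             (bounds≤sum f ((t≢z ∷ []) ∷ [] ∷ []) (≤-reflexive (sym ft≡2) ∷ ≤-reflexive (sym fz≡2) ∷ []))
  zero-off-edge : ∀ x → x ≢ z → x ≢ y → f x ≡ 0
  zero-off-edge x x≢z x≢y = decidable-stable (f x ℕ.≟ 0) λ fx≢0 →
    <-irrefl (sym w≡3) (bounds≤sum f ((adj⇒≢ G zy ∷ x≢z ∘ sym ∷ []) ∷ (x≢y ∘ sym ∷ []) ∷ [] ∷ [])
                                    (≤-reflexive (sym fz≡2) ∷ 1≤fy ∷ n≢0⇒n>0 fx≢0 ∷ []))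
  dominating : Dominating G z
  dominating x x≢z with toSum (x ≟ y)
  ... | inj₁ refl = zy
  ... | inj₂ x≢y with IsQTRDF.dom q x (zero-off-edge x x≢z x≢y)
  ...   | t , xt , ft≡2 with only-z-has-value-2 t ft≡2
  ...     | refl = trans (adj-sym G t x) xt

weight≡4⇒almost-dominating : ∀ {n} {H : Graph n} {f v z y} → Isolated H v → IsQTRDF H f → sum f ≡ 4 →
                             f z ≡ 2 → adj H z y ≡ true → 1 ≤ f y → ∀ x → x ≢ v → x ≢ z → adj H z x ≡ true
weight≡4⇒almost-dominating {H = H} {f} {v} {z} {y} iso q w≡4 fz≡2 zy 1≤fy x x≢v x≢z =
  [ (λ { refl → zy }) , dominated-by-z ]′ (toSum (x ≟ y))
  where
  v≢z : v ≢ z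
  v≢z = proj₁ (isolated∉edge H iso zy)
  zero-off-edge : x ≢ y → f x ≡ 0
  zero-off-edge x≢y = decidable-stable (f x ℕ.≟ 0) λ fx≢0 → <-irrefl (sym w≡4)
    (bounds≤sum f ((v≢z ∷ proj₂ (isolated∉edge H iso zy) ∷ x≢v ∘ sym ∷ [])
                   ∷ (adj⇒≢ H zy ∷ x≢z ∘ sym ∷ []) ∷ (x≢y ∘ sym ∷ []) ∷ [] ∷ [])
                  (isolated⇒positive q iso ∷ ≤-reflexive (sym fz≡2) ∷ 1≤fy ∷ n≢0⇒n>0 fx≢0 ∷ []))
  dominated-by-z : x ≢ y → adj H z x ≡ true
  dominated-by-z x≢y with IsQTRDF.dom q x (zero-off-edge x≢y)
  ... | t , xt , ft≡2 with toSum (t ≟ z)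
  ...   | inj₁ refl = trans (adj-sym H t x) xt
  ...   | inj₂ t≢z = ⊥-elim (<-irrefl (sym w≡4)
    (bounds≤sum f ((t≢z ∘ sym ∷ v≢z ∘ sym ∷ []) ∷ (proj₂ (isolated∉edge H iso xt) ∘ sym ∷ []) ∷ [] ∷ [])
                  (≤-reflexive (sym fz≡2) ∷ ≤-reflexive (sym ft≡2) ∷ isolated⇒positive q iso ∷ [])))

-- Two constructions, and the upper bounds they give

all-ones : ∀ {n} (G : Graph n) → IsQTRDF G (λ _ → 1)
all-ones G = record { range = λ _ → s≤s z≤n ; dom = λ _ () ; quasi = λ _ _ _ → refl }

γ≤n : ∀ {n} {G : Graph n} {a} → IsγqtR G a → a ≤ n
γ≤n {n} {G} γ = ≤-trans (γ≤ γ (all-ones G)) (≤-reflexive (sum-one n))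

star : ∀ {n} → Graph n → Fin n → Fin n → Fin n → ℕ
star G v u x = δ v x + δ u x + 𝟙 (not (adj G v x))

star-weight : ∀ {n} (G : Graph n) v u → sum (star G v u) + deg G v ≡ n + 2
star-weight {n} G v u = begin
  sum (star G v u) + deg G v                   ≡⟨ cong (_+ deg G v) (∑-distrib-+ (λ x → δ v x + δ u x) N) ⟩
  sum (λ x → δ v x + δ u x) + sum N + deg G v  ≡⟨ cong (λ s → s + sum N + deg G v) (∑-distrib-+ (δ v) (δ u)) ⟩
  sum (δ v) + sum (δ u) + sum N + deg G v      ≡⟨ cong₂ (λ p q → p + q + sum N + deg G v) (sum-δ v) (sum-δ u) ⟩
  2 + sum N + deg G v                          ≡⟨ +-assoc 2 (sum N) (deg G v) ⟩
  2 + (sum N + deg G v)                        ≡⟨ cong (2 +_) (sum-nonadj+deg G v) ⟩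
  2 + n                                        ≡⟨ +-comm 2 n ⟩
  n + 2                                        ∎
  where
  open ≡-Reasoning
  N : Fin n → ℕ
  N = 𝟙 ∘ not ∘ adj G v

module Star {n} (G : Graph n) {v u : Fin n} (vu : adj G v u ≡ true) where

  private
    f : Fin n → ℕ
    f = star G v u
    u≢v : u ≢ v
    u≢v = adj⇒≢ G vu ∘ sym

  centre : f v ≡ 2
  centre rewrite δ-self v | δ-other (u≢v ∘ sym) | adj-irrefl G v = refl

  leaf : f u ≡ 1
  leaf rewrite δ-other u≢v | δ-self u | vu = refl

  off-centre≤1 : ∀ x → x ≢ v → f x ≤ 1
  off-centre≤1 x x≢v with toSum (x ≟ u)
  ... | inj₁ refl = ≤-reflexive leaf
  ... | inj₂ x≢u rewrite δ-other x≢v | δ-other x≢u = 𝟙≤1 (not (adj G v x))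

  zero⇒adj : ∀ x → f x ≡ 0 → adj G v x ≡ true
  zero⇒adj x fx≡0 =
    trans (sym (Boolₚ.not-involutive (adj G v x))) (cong not (𝟙≡0⇒false (m+n≡0⇒n≡0 (δ v x + δ u x) fx≡0)))

  qtrdf : IsQTRDF G f
  qtrdf = record { range = range ; dom = dom ; quasi = quasi }
    where
    range : ∀ x → f x ≤ 2
    range x with toSum (x ≟ v)
    ... | inj₁ refl = ≤-reflexive centre
    ... | inj₂ x≢v = ≤-trans (off-centre≤1 x x≢v) (s≤s z≤n)
    dom : ∀ x → f x ≡ 0 → ∃ λ t → adj G x t ≡ true × f t ≡ 2
    dom x fx≡0 = v , trans (adj-sym G x v) (zero⇒adj x fx≡0) , centre
    quasi : ∀ x → 1 ≤ f x → (∀ y → adj G x y ≡ true → f y ≡ 0) → f x ≡ 1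
    quasi x 1≤fx alone with toSum (x ≟ v)
    ... | inj₁ refl = contradiction (trans (sym leaf) (alone u vu)) λ ()
    ... | inj₂ x≢v = ≤-antisym (off-centre≤1 x x≢v) 1≤fx

γ+deg≤n+2 : ∀ {n} {G : Graph n} {a v u} → IsγqtR G a → adj G v u ≡ true → a + deg G v ≤ n + 2
γ+deg≤n+2 {G = G} {v = v} {u} γ vu =
  ≤-trans (+-monoˡ-≤ (deg G v) (γ≤ γ (Star.qtrdf G vu))) (≤-reflexive (star-weight G v u))

γ≤3-of-dominating : ∀ {n} {G : Graph n} {a v} → 2 ≤ n → IsγqtR G a → Dominating G v → a ≤ 3
γ≤3-of-dominating {n} {G} {a} {v} 2≤n γ dom with another-vertex 2≤n v
... | u , u≢v = +-cancelʳ-≤ (deg G v) a 3 (begin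
  a + deg G v        ≤⟨ γ+deg≤n+2 γ (dom u u≢v) ⟩
  n + 2              ≡⟨ cong (_+ 2) (dominating⇒deg G dom) ⟨
  deg G v + 1 + 2    ≡⟨ +-comm (deg G v + 1) 2 ⟩
  2 + (deg G v + 1)  ≡⟨ cong (2 +_) (+-comm (deg G v) 1) ⟩
  3 + deg G v        ∎)
  where open ≤-Reasoning

γ+deg≡n+2⇒2≤deg : ∀ {n} {H : Graph n} {c v} → IsγqtR H c → c + deg H v ≡ n + 2 → 2 ≤ deg H v
γ+deg≡n+2⇒2≤deg {n} {H} {v = v} γ c+d≡n+2 =
  +-cancelˡ-≤ n 2 (deg H v) (subst (_≤ n + deg H v) c+d≡n+2 (+-monoˡ-≤ (deg H v) (γ≤n γ)))

edge : ∀ {n} → Graph n → Fin n → Fin n → Fin n → ℕ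
edge G v x y = 2 * δ v y + 2 * δ x y + 𝟙 (not (adj G v y) ∧ not (adj G x y))

PrivateNeighbour : ∀ {n} → Graph n → Fin n → Fin n → Fin n → Set
PrivateNeighbour G v x y = adj G x y ≡ true × adj G v y ≡ false × y ≢ v

module Edge {n} (G : Graph n) {v x : Fin n} (vx : adj G v x ≡ true) where

  private
    f : Fin n → ℕ
    f = edge G v x
    v≢x : v ≢ x
    v≢x = adj⇒≢ G vx

  end₁ : f v ≡ 2
  end₁ rewrite δ-self v | δ-other v≢x | adj-irrefl G v | adj-sym G x v | vx = refl

  end₂ : f x ≡ 2
  end₂ rewrite δ-other (v≢x ∘ sym) | δ-self x | vx = refl

  inner≤1 : ∀ y → y ≢ v → y ≢ x → f y ≤ 1
  inner≤1 y y≢v y≢x rewrite δ-other y≢v | δ-other y≢x = 𝟙≤1 _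

  zero⇒adj : ∀ y → f y ≡ 0 → adj G v y ≡ true ⊎ adj G x y ≡ true
  zero⇒adj y fy≡0 with adj G v y | adj G x y | 𝟙≡0⇒false (m+n≡0⇒n≡0 (2 * δ v y + 2 * δ x y) fy≡0)
  ... | true | _ | _ = inj₁ refl
  ... | false | true | _ = inj₂ refl

  qtrdf : IsQTRDF G f
  qtrdf = record { range = range ; dom = dom ; quasi = quasi }
    where
    range : ∀ y → f y ≤ 2
    range y with toSum (y ≟ v) | toSum (y ≟ x)
    ... | inj₁ refl | _ = ≤-reflexive end₁
    ... | inj₂ _ | inj₁ refl = ≤-reflexive end₂
    ... | inj₂ y≢v | inj₂ y≢x = ≤-trans (inner≤1 y y≢v y≢x) (s≤s z≤n)
    dom : ∀ y → f y ≡ 0 → ∃ λ t → adj G y t ≡ true × f t ≡ 2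
    dom y fy≡0 with zero⇒adj y fy≡0
    ... | inj₁ vy = v , trans (adj-sym G y v) vy , end₁
    ... | inj₂ xy = x , trans (adj-sym G y x) xy , end₂
    quasi : ∀ y → 1 ≤ f y → (∀ t → adj G y t ≡ true → f t ≡ 0) → f y ≡ 1
    quasi y 1≤fy alone with toSum (y ≟ v) | toSum (y ≟ x)
    ... | inj₁ refl | _ = contradiction (trans (sym end₂) (alone x vx)) λ ()
    ... | inj₂ _ | inj₁ refl = contradiction (trans (sym end₁) (alone v (trans (adj-sym G y v) vx))) λ ()
    ... | inj₂ y≢v | inj₂ y≢x = ≤-antisym (inner≤1 y y≢v y≢x) 1≤fy

  -- Among the n ∸ deg v non-neighbours of v (v included), at least v, y₁ and y₂ lie in N(x),
  -- so they do not get value 1.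
  weight-bound : ∀ {y₁ y₂} → PrivateNeighbour G v x y₁ → PrivateNeighbour G v x y₂ → y₁ ≢ y₂ →
           sum f + deg G v ≤ n + 1
  weight-bound {y₁} {y₂} (xy₁ , ¬vy₁ , y₁≢v) (xy₂ , ¬vy₂ , y₂≢v) y₁≢y₂ =
    +-cancelʳ-≤ 3 (sum f + deg G v) (n + 1) (begin
      sum f + deg G v + 3                    ≡⟨ cong (λ s → s + deg G v + 3) sum-f ⟩
      4 + sum A + deg G v + 3                ≡⟨ rearrange (sum A) (deg G v) ⟩
      4 + (sum A + 3 + deg G v)              ≤⟨ +-monoʳ-≤ 4 (+-monoˡ-≤ (deg G v) (+-monoʳ-≤ (sum A) 3≤sum-B)) ⟩
      4 + (sum A + sum B + deg G v)          ≡⟨ cong (λ s → 4 + (s + deg G v)) (∑-distrib-+ A B) ⟨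
      4 + (sum (λ y → A y + B y) + deg G v)  ≡⟨ cong (λ s → 4 + (s + deg G v)) (sum-cong-≗ N≡A+B) ⟨
      4 + (sum N + deg G v)                  ≡⟨ cong (4 +_) (sum-nonadj+deg G v) ⟩
      4 + n                                  ≡⟨ trans (+-comm 4 n) (sym (+-assoc n 1 3)) ⟩
      n + 1 + 3                              ∎)
    where
    open ≤-Reasoning
    N : Fin n → ℕ
    N = 𝟙 ∘ not ∘ adj G v
    A : Fin n → ℕ
    A y = 𝟙 (not (adj G v y) ∧ not (adj G x y))
    B : Fin n → ℕ
    B y = 𝟙 (not (adj G v y) ∧ not (not (adj G x y)))
    N≡A+B : ∀ y → N y ≡ A y + B y
    N≡A+B y = 𝟙-split (not (adj G v y)) (not (adj G x y))
    rearrange : ∀ s d → 4 + s + d + 3 ≡ 4 + (s + 3 + d)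
    rearrange = solve-∀
    sum-2δ : ∀ w → sum (λ y → 2 * δ w y) ≡ 2
    sum-2δ w = trans (sym (*-distribˡ-sum 2 (δ w))) (cong (2 *_) (sum-δ w))
    sum-f : sum f ≡ 4 + sum A
    sum-f = begin-equality
      sum f
        ≡⟨ ∑-distrib-+ (λ y → 2 * δ v y + 2 * δ x y) A ⟩
      sum (λ y → 2 * δ v y + 2 * δ x y) + sum A
        ≡⟨ cong (_+ sum A) (∑-distrib-+ (λ y → 2 * δ v y) (λ y → 2 * δ x y)) ⟩
      sum (λ y → 2 * δ v y) + sum (λ y → 2 * δ x y) + sum A
        ≡⟨ cong₂ (λ p q → p + q + sum A) (sum-2δ v) (sum-2δ x) ⟩
      4 + sum A
        ∎
    1≤B : ∀ {y} → adj G x y ≡ true → adj G v y ≡ false → 1 ≤ B y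
    1≤B {y} xy ¬vy rewrite xy | ¬vy = ≤-refl
    3≤sum-B : 3 ≤ sum B
    3≤sum-B = bounds≤sum B ((y₁≢v ∘ sym ∷ y₂≢v ∘ sym ∷ []) ∷ (y₁≢y₂ ∷ []) ∷ [] ∷ [])
                   (1≤B (trans (adj-sym G x v) vx) (adj-irrefl G v) ∷ 1≤B xy₁ ¬vy₁ ∷ 1≤B xy₂ ¬vy₂ ∷ [])

at-most-one-private-neighbour : ∀ {n} {H : Graph n} {c v x y₁ y₂} → IsγqtR H c → c + deg H v ≡ n + 2 →
  adj H v x ≡ true → PrivateNeighbour H v x y₁ → PrivateNeighbour H v x y₂ → y₁ ≡ y₂
at-most-one-private-neighbour {n} {H} {c} {v} {y₁ = y₁} {y₂} γ tight vx p₁ p₂ =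
  decidable-stable (y₁ ≟ y₂) λ y₁≢y₂ → contradiction (+-cancelˡ-≤ n 2 1 (begin
    n + 2                       ≡⟨ tight ⟨
    c + deg H v                 ≤⟨ +-monoˡ-≤ (deg H v) (γ≤ γ (Edge.qtrdf H vx)) ⟩
    sum (edge H v _) + deg H v  ≤⟨ Edge.weight-bound H vx p₁ p₂ y₁≢y₂ ⟩
    n + 1                       ∎)) λ { (s≤s ()) }
  where open ≤-Reasoning

-- The Nordhaus–Gaddum bounds

m*k≤k+m⇒m≡2×k≡2 : ∀ {m k} → 2 ≤ m → 2 ≤ k → m * k ≤ k + m → m ≡ 2 × k ≡ 2
m*k≤k+m⇒m≡2×k≡2 {suc (suc p)} {suc (suc q)} (s≤s (s≤s _)) (s≤s (s≤s _)) mk≤k+m =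
  cong (2 +_) (n≤0⇒n≡0 p≤0) , cong (2 +_) (n≤0⇒n≡0 q≤0)
  where
  open ≤-Reasoning
  identity : ∀ p q → (1 + p) * (1 + q) + 1 ≡ p * q + ((1 + q) + (1 + p))
  identity = solve-∀
  pq≤1 : suc p * suc q ≤ 1
  pq≤1 = +-cancelʳ-≤ (suc (suc q) + suc (suc p)) (suc p * suc q) 1 (begin
    suc p * suc q + (suc (suc q) + suc (suc p))  ≡⟨ identity (suc p) (suc q) ⟨
    suc (suc p) * suc (suc q) + 1                ≤⟨ +-monoˡ-≤ 1 mk≤k+m ⟩
    suc (suc q) + suc (suc p) + 1                ≡⟨ +-comm _ 1 ⟩
    1 + (suc (suc q) + suc (suc p))              ∎)
  q≤0 : q ≤ 0
  q≤0 = m+n≤o⇒m≤o q (≤-pred pq≤1)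
  p≤0 : p ≤ 0
  p≤0 = ≤-trans (m≤m*n p (suc q)) (m+n≤o⇒n≤o q (≤-pred pq≤1))

γ≡3⇒γ-complement≥4 : ∀ {n} {G : Graph n} {a b} → 4 ≤ n → IsγqtR G a → IsγqtR (complement G) b →
                     a ≡ 3 → 4 ≤ b
γ≡3⇒γ-complement≥4 {G = G} 4≤n γa γb refl with γ-attained γa
... | f , q , w≡3 with weight≡3⇒dominating 4≤n q w≡3
...   | v , dom = ≤γ (λ _ → isolated⇒weight≥4 4≤n (dominating⇒isolated-complement G dom)) γb

module NordhausGaddum {n} (4≤n : 4 ≤ n) {G : Graph n} {a b : ℕ}
                      (γa : IsγqtR G a) (γb : IsγqtR (complement G) b) where

  private
    Ḡ : Graph n
    Ḡ = complement G
    2≤n : 2 ≤ n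
    2≤n = <⇒≤ (<⇒≤ 4≤n)

  extreme-vertex⇒sum≤n+3 : ∀ {v} → Dominating G v ⊎ Isolated G v → a + b ≤ n + 3
  extreme-vertex⇒sum≤n+3 (inj₁ dom) =
    subst (a + b ≤_) (+-comm 3 n) (+-mono-≤ (γ≤3-of-dominating 2≤n γa dom) (γ≤n γb))
  extreme-vertex⇒sum≤n+3 (inj₂ iso) =
    +-mono-≤ (γ≤n γa) (γ≤3-of-dominating 2≤n γb (isolated⇒dominating-complement G iso))

  vertex-bound : ∀ v → a + b ≤ n + 3 ⊎ (a + deg G v ≤ n + 2 × b + deg Ḡ v ≤ n + 2)
  vertex-bound v with isolated⊎neighbour G v | isolated⊎neighbour Ḡ v
  ... | inj₁ iso | _ = inj₁ (extreme-vertex⇒sum≤n+3 (inj₂ iso))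
  ... | inj₂ _ | inj₁ iso = inj₁ (extreme-vertex⇒sum≤n+3 (inj₁ (isolated-complement⇒dominating G iso)))
  ... | inj₂ (u , vu) | inj₂ (w , vw) = inj₂ (γ+deg≤n+2 γa vu , γ+deg≤n+2 γb vw)

  private
    rearrange : ∀ a b d₁ d₂ → a + d₁ + (b + d₂) + 1 ≡ a + b + (d₁ + d₂ + 1)
    rearrange = solve-∀
    twice-n+2 : ∀ n → n + 2 + (n + 2) + 1 ≡ n + 5 + n
    twice-n+2 = solve-∀
    v₀ : Fin n
    v₀ = fromℕ< {0} (≤-trans (s≤s z≤n) 4≤n)

  local-sum : ∀ v → a + deg G v + (b + deg Ḡ v) + 1 ≡ a + b + n
  local-sum v = trans (rearrange a b (deg G v) (deg Ḡ v)) (cong (a + b +_) (deg-complement G v))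

  sum≤n+5 : a + b ≤ n + 5
  sum≤n+5 with vertex-bound v₀
  ... | inj₁ ≤n+3 = ≤-trans ≤n+3 (+-monoʳ-≤ n (s≤s (s≤s (s≤s z≤n))))
  ... | inj₂ (a≤ , b≤) = +-cancelʳ-≤ n (a + b) (n + 5) (begin
    a + b + n                          ≡⟨ local-sum v₀ ⟨
    a + deg G v₀ + (b + deg Ḡ v₀) + 1  ≤⟨ +-monoˡ-≤ 1 (+-mono-≤ a≤ b≤) ⟩
    n + 2 + (n + 2) + 1                ≡⟨ twice-n+2 n ⟩
    n + 5 + n                          ∎)
    where open ≤-Reasoning

  7≤sum : 7 ≤ a + b
  7≤sum with a ℕ.≟ 3
  ... | yes refl = +-monoʳ-≤ 3 (γ≡3⇒γ-complement≥4 4≤n γa γb refl)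
  ... | no a≢3 = +-mono-≤ (≤∧≢⇒< (3≤γ 3≤n γa) (a≢3 ∘ sym)) (3≤γ 3≤n γb)
    where
    3≤n : 3 ≤ n
    3≤n = <⇒≤ 4≤n

  module Extremal (sum≡n+5 : a + b ≡ n + 5) where

    tight : ∀ v → a + deg G v ≡ n + 2 × b + deg Ḡ v ≡ n + 2
    tight v with vertex-bound v
    ... | inj₁ ≤n+3 =
      contradiction (+-cancelˡ-≤ n 5 3 (subst (_≤ n + 3) sum≡n+5 ≤n+3)) λ { (s≤s (s≤s (s≤s ()))) }
    ... | inj₂ (a≤ , b≤) = both-equal a≤ b≤ (+-cancelʳ-≡ 1 _ _ (begin
      a + deg G v + (b + deg Ḡ v) + 1  ≡⟨ local-sum v ⟩
      a + b + n                        ≡⟨ cong (_+ n) sum≡n+5 ⟩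
      n + 5 + n                        ≡⟨ twice-n+2 n ⟨
      n + 2 + (n + 2) + 1              ∎))
      where
      open ≡-Reasoning
      both-equal : ∀ {x y p} → x ≤ p → y ≤ p → x + y ≡ p + p → x ≡ p × y ≡ p
      both-equal {x} {y} {p} x≤p y≤p x+y≡p+p =
          ≤-antisym x≤p (+-cancelʳ-≤ p p x (subst (_≤ x + p) x+y≡p+p (+-monoʳ-≤ x y≤p)))
        , ≤-antisym y≤p (+-cancelˡ-≤ p p y (subst (_≤ p + y) x+y≡p+p (+-monoˡ-≤ y x≤p)))

    -- Count the pairs (x , y) with x ∈ N_Ḡ(v), y ∈ N_G(v) and x ∼ y in G: each y has at most one such x
    -- (a private neighbour in G), and each x misses at most one such y (a private neighbour in Ḡ).
    module Count (v : Fin n) where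

      pairs : Fin n → Fin n → ℕ
      pairs x y = 𝟙 (adj Ḡ v x ∧ adj G v y ∧ adj G x y)

      column≤1 : ∀ y → sum (λ x → pairs x y) ≤ 𝟙 (adj G v y)
      column≤1 y with adj G v y in vy
      ... | false = ≤-reflexive (trans (sum-cong-≗ (λ x → cong 𝟙 (Boolₚ.∧-zeroʳ (adj Ḡ v x)))) (sum-zero n))
      ... | true = sum-𝟙≤1 (λ x → adj Ḡ v x ∧ adj G x y) λ x₁ x₂ p₁ p₂ →
        at-most-one-private-neighbour γa (proj₁ (tight v)) vy (private-in-G p₁) (private-in-G p₂)
        where
        private-in-G : ∀ {x} → adj Ḡ v x ∧ adj G x y ≡ true → PrivateNeighbour G v y x
        private-in-G {x} p with ∧≡true p
        ... | vx̄ , xy = trans (adj-sym G y x) xy , adj-complement⇒¬adj G vx̄ , adj⇒≢ Ḡ vx̄ ∘ sym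

      row≥ : ∀ x → 𝟙 (adj Ḡ v x) * deg G v ≤ sum (pairs x) + 𝟙 (adj Ḡ v x)
      row≥ x with adj Ḡ v x in vx̄
      ... | false = z≤n
      ... | true = begin
        1 * deg G v                      ≡⟨ *-identityˡ (deg G v) ⟩
        deg G v                          ≡⟨ deg≡sum G v ⟩
        sum (𝟙 ∘ adj G v)                ≡⟨ sum-cong-≗ (λ y → 𝟙-split (adj G v y) (adj G x y)) ⟩
        sum (λ y → common y + missed y)  ≡⟨ ∑-distrib-+ common missed ⟩
        sum common + sum missed          ≤⟨ +-monoʳ-≤ (sum common) missed≤1 ⟩
        sum common + 1                   ∎
        where
        open ≤-Reasoning
        private-in-Ḡ : ∀ {y} → adj G v y ∧ not (adj G x y) ≡ true → PrivateNeighbour Ḡ v x y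
        private-in-Ḡ {y} p with ∧≡true p
        ... | vy , ¬xy = ¬adj⇒adj-complement G (Boolₚ.not-injective ¬xy) x≢y
                       , adj⇒¬adj-complement G vy , adj⇒≢ G vy ∘ sym
          where
          x≢y : x ≢ y
          x≢y refl = false≢true (trans (sym (adj-complement⇒¬adj G vx̄)) vy)
        common missed : Fin n → ℕ
        common y = 𝟙 (adj G v y ∧ adj G x y)
        missed y = 𝟙 (adj G v y ∧ not (adj G x y))
        missed≤1 : sum missed ≤ 1
        missed≤1 = sum-𝟙≤1 _ λ y₁ y₂ p₁ p₂ →
          at-most-one-private-neighbour γb (proj₂ (tight v)) vx̄ (private-in-Ḡ p₁) (private-in-Ḡ p₂)

      count : deg Ḡ v * deg G v ≤ deg G v + deg Ḡ v
      count = begin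
        deg Ḡ v * deg G v                              ≡⟨ cong (_* deg G v) (deg≡sum Ḡ v) ⟩
        sum (𝟙 ∘ adj Ḡ v) * deg G v                    ≡⟨ *-distribʳ-sum (deg G v) (𝟙 ∘ adj Ḡ v) ⟩
        sum (λ x → 𝟙 (adj Ḡ v x) * deg G v)            ≤⟨ sum-mono-≤ row≥ ⟩
        sum (λ x → sum (pairs x) + 𝟙 (adj Ḡ v x))      ≡⟨ ∑-distrib-+ (λ x → sum (pairs x)) (𝟙 ∘ adj Ḡ v) ⟩
        sum (λ x → sum (pairs x)) + sum (𝟙 ∘ adj Ḡ v)  ≡⟨ cong₂ _+_ (∑-comm pairs) (sym (deg≡sum Ḡ v)) ⟩
        sum (λ y → sum (λ x → pairs x y)) + deg Ḡ v    ≤⟨ +-monoˡ-≤ (deg Ḡ v) (sum-mono-≤ column≤1) ⟩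
        sum (𝟙 ∘ adj G v) + deg Ḡ v                    ≡⟨ cong (_+ deg Ḡ v) (deg≡sum G v) ⟨
        deg G v + deg Ḡ v                              ∎
        where open ≤-Reasoning

    order-5-and-2-regular : n ≡ 5 × ∀ u → deg G u ≡ 2
    order-5-and-2-regular = n≡5 , 2-regular
      where
      degrees : deg Ḡ v₀ ≡ 2 × deg G v₀ ≡ 2
      degrees = m*k≤k+m⇒m≡2×k≡2 (γ+deg≡n+2⇒2≤deg γb (proj₂ (tight v₀))) (γ+deg≡n+2⇒2≤deg γa (proj₁ (tight v₀)))
                                (Count.count v₀)
      n≡5 : n ≡ 5
      n≡5 = trans (sym (deg-complement G v₀)) (cong₂ (λ p q → p + q + 1) (proj₂ degrees) (proj₁ degrees))
      2-regular : ∀ u → deg G u ≡ 2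
      2-regular u =
        +-cancelˡ-≡ a _ _ (trans (proj₁ (tight u)) (trans (sym (proj₁ (tight v₀))) (cong (a +_) (proj₂ degrees))))

-- Invariance under isomorphism

≈ᴳ⇒≅ : ∀ {n} {G H : Graph n} → G ≈ᴳ H → G ≅ H
≈ᴳ⇒≅ G≈H = mk↔ₛ′ id id (λ _ → refl) (λ _ → refl) , G≈H

≅-refl : ∀ {n} {G : Graph n} → G ≅ G
≅-refl {G = G} = ≈ᴳ⇒≅ {G = G} {G} (λ _ _ → refl)

≅-respˡ-≈ᴳ : ∀ {n m} {G H : Graph n} {K : Graph m} → G ≈ᴳ H → H ≅ K → G ≅ K
≅-respˡ-≈ᴳ G≈H (σ , H≅K) = σ , λ i j → trans (G≈H i j) (H≅K i j)

≅-sym : ∀ {n m} {G : Graph n} {H : Graph m} → G ≅ H → H ≅ G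
≅-sym {G = G} {H} (σ , G≅H) = ↔-sym σ , λ i j →
  sym (trans (G≅H (Inverse.from σ i) (Inverse.from σ j))
             (cong₂ (adj H) (Inverse.strictlyInverseˡ σ i) (Inverse.strictlyInverseˡ σ j)))

≅-complement : ∀ {n m} {G : Graph n} {H : Graph m} → G ≅ H → complement G ≅ complement H
≅-complement {n} {m} {G} {H} (σ , G≅H) = σ , λ i j → begin
  adj (complement G) i j                               ≡⟨ adj-complement G i j ⟩
  not (adj G i j) ∧ not (eqᵇ i j)                      ≡⟨ cong₂ (λ p q → not p ∧ not q) (G≅H i j) (eqᵇ-to i j) ⟩
  not (adj H (to i) (to j)) ∧ not (eqᵇ (to i) (to j))  ≡⟨ adj-complement H (to i) (to j) ⟨
  adj (complement H) (to i) (to j)                     ∎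
  where
  open ≡-Reasoning
  to : Fin n → Fin m
  to = Inverse.to σ
  eqᵇ-to : ∀ i j → eqᵇ i j ≡ eqᵇ (to i) (to j)
  eqᵇ-to i j with toSum (i ≟ j)
  ... | inj₁ refl = trans (eqᵇ-refl i) (sym (eqᵇ-refl (to i)))
  ... | inj₂ i≢j = trans (eqᵇ-≢ i≢j) (sym (eqᵇ-≢ (i≢j ∘ to-injective)))
    where
    to-injective : ∀ {i j} → to i ≡ to j → i ≡ j
    to-injective {i} {j} e =
      trans (sym (Inverse.strictlyInverseʳ σ i)) (trans (cong (Inverse.from σ) e) (Inverse.strictlyInverseʳ σ j))

qtrdf-≅ : ∀ {n m} {G : Graph n} {H : Graph m} {f} (iso : G ≅ H) →
          IsQTRDF G f → IsQTRDF H (f ∘ Inverse.from (proj₁ iso))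
qtrdf-≅ {n} {m} {G} {H} {f} iso q = record { range = IsQTRDF.range q ∘ from ; dom = dom ; quasi = quasi }
  where
  σ : Fin n ↔ Fin m
  σ = proj₁ iso
  to : Fin n → Fin m
  to = Inverse.to σ
  from : Fin m → Fin n
  from = Inverse.from σ
  from-to : ∀ x → from (to x) ≡ x
  from-to = Inverse.strictlyInverseʳ σ
  adj-to : ∀ u x → adj H u (to x) ≡ adj G (from u) x
  adj-to u x = trans (proj₂ (≅-sym {G = G} {H} iso) u (to x)) (cong (adj G (from u)) (from-to x))
  dom : ∀ u → f (from u) ≡ 0 → ∃ λ t → adj H u t ≡ true × f (from t) ≡ 2
  dom u fu≡0 with IsQTRDF.dom q (from u) fu≡0
  ... | t , ut , ft≡2 = to t , trans (adj-to u t) ut , trans (cong f (from-to t)) ft≡2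
  quasi : ∀ x → 1 ≤ f (from x) → (∀ y → adj H x y ≡ true → f (from y) ≡ 0) → f (from x) ≡ 1
  quasi x 1≤fx alone = IsQTRDF.quasi q (from x) 1≤fx λ y xy →
    trans (cong f (sym (from-to y))) (alone (to y) (trans (adj-to x y) xy))

γ-≅ : ∀ {n m} {G : Graph n} {H : Graph m} {a} → G ≅ H → IsγqtR G a → IsγqtR H a
γ-≅ {n} {m} {G} {H} {a} iso γ = record { witness = witness ; minimal = minimal }
  where
  σ : Fin n ↔ Fin m
  σ = proj₁ iso
  witness : Σ (Fin _ → ℕ) λ f → IsQTRDF H f × weight f ≡ a
  witness with γ-attained γ
  ... | f , q , w = f ∘ Inverse.from σ , qtrdf-≅ iso q
                  , trans (weight≡sum (f ∘ Inverse.from σ)) (trans (sym (sum-permute f (↔-sym σ))) w)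
  minimal : ∀ f → IsQTRDF H f → a ≤ weight f
  minimal f q = subst (a ≤_) (trans (sym (sum-permute f σ)) (sym (weight≡sum f)))
                       (γ≤ γ (qtrdf-≅ (≅-sym {G = G} {H} iso) q))

-- Exhaustive checks on graphs of order 4 and 5

Exhaustible : Set → Set₁
Exhaustible A = ∀ {P : A → Set} → Decidable P → Dec (∃ P)

∀? : ∀ {A} → Exhaustible A → ∀ {P : A → Set} → Decidable P → Dec (∀ x → P x)
∀? search P? = map′ (λ ¬counterexample x → decidable-stable (P? x) (λ ¬Px → ¬counterexample (x , ¬Px)))
                    (λ ∀P (x , ¬Px) → ¬Px (∀P x))
                    (¬? (search (¬? ∘ P?)))

Bool-exhaustible : Exhaustible Bool
Bool-exhaustible P? = map′ [ (true ,_) , (false ,_) ]′ split (P? true ⊎-dec P? false)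
  where
  split : ∀ {P : Bool → Set} → ∃ P → P true ⊎ P false
  split (true , p) = inj₁ p
  split (false , p) = inj₂ p

Vec-exhaustible : ∀ {A k} → Exhaustible A → Exhaustible (Vec A k)
Vec-exhaustible {k = zero} search P? = map′ ([] ,_) (λ { ([] , p) → p }) (P? [])
Vec-exhaustible {k = suc k} search P? =
  map′ (λ (x , xs , p) → x ∷ xs , p) (λ { (x ∷ xs , p) → x , xs , p })
       (search (λ x → Vec-exhaustible search (λ xs → P? (x ∷ xs))))

×-exhaustible : ∀ {A B} → Exhaustible A → Exhaustible B → Exhaustible (A × B)
×-exhaustible searchA searchB P? =
  map′ (λ (x , y , p) → (x , y) , p) (λ ((x , y) , p) → x , y , p)
       (searchA (λ x → searchB (λ y → P? (x , y))))

-- A graph on Fin (suc n) is its row of adjacencies from 0 to the other vertices together with a graph on Fin n.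
Triangle : ℕ → Set
Triangle zero = ⊤
Triangle (suc n) = Vec Bool n × Triangle n

Triangle-exhaustible : ∀ {n} → Exhaustible (Triangle n)
Triangle-exhaustible {zero} P? = map′ (tt ,_) proj₂ (P? tt)
Triangle-exhaustible {suc n} = ×-exhaustible (Vec-exhaustible Bool-exhaustible) Triangle-exhaustible

triangle-adj : ∀ {n} → Triangle n → Fin n → Fin n → Bool
triangle-adj (r , t) zero zero = false
triangle-adj (r , t) zero (suc j) = lookup r j
triangle-adj (r , t) (suc i) zero = lookup r i
triangle-adj (r , t) (suc i) (suc j) = triangle-adj t i j

triangle-adj-sym : ∀ {n} (t : Triangle n) i j → triangle-adj t i j ≡ triangle-adj t j i
triangle-adj-sym (r , t) zero zero = refl
triangle-adj-sym (r , t) zero (suc j) = refl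
triangle-adj-sym (r , t) (suc i) zero = refl
triangle-adj-sym (r , t) (suc i) (suc j) = triangle-adj-sym t i j

triangle-adj-irrefl : ∀ {n} (t : Triangle n) i → triangle-adj t i i ≡ false
triangle-adj-irrefl (r , t) zero = refl
triangle-adj-irrefl (r , t) (suc i) = triangle-adj-irrefl t i

fromTriangle : ∀ {n} → Triangle n → Graph n
fromTriangle t = record { adj = triangle-adj t ; adj-sym = triangle-adj-sym t ; adj-irrefl = triangle-adj-irrefl t }

toTriangle : ∀ {n} → (Fin n → Fin n → Bool) → Triangle n
toTriangle {zero} r = tt
toTriangle {suc n} r = Vec.tabulate (r zero ∘ suc) , toTriangle (λ i j → r (suc i) (suc j))

triangle-adj-toTriangle : ∀ {n} (r : Fin n → Fin n → Bool) → (∀ i j → r i j ≡ r j i) →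
                          (∀ i → r i i ≡ false) → ∀ i j → triangle-adj (toTriangle r) i j ≡ r i j
triangle-adj-toTriangle r r-sym r-irrefl zero zero = sym (r-irrefl zero)
triangle-adj-toTriangle r r-sym r-irrefl zero (suc j) = lookup∘tabulate (r zero ∘ suc) j
triangle-adj-toTriangle r r-sym r-irrefl (suc i) zero =
  trans (lookup∘tabulate (r zero ∘ suc) i) (r-sym zero (suc i))
triangle-adj-toTriangle r r-sym r-irrefl (suc i) (suc j) =
  triangle-adj-toTriangle (λ i j → r (suc i) (suc j)) (λ i j → r-sym (suc i) (suc j)) (r-irrefl ∘ suc) i j

by-triangles : ∀ {n} (P : Graph n → Set) → (∀ G H → G ≈ᴳ H → P H → P G) →
               (∀ t → P (fromTriangle t)) → ∀ G → P G
by-triangles P resp all G = resp G (fromTriangle t) G≈t (all t)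
  where
  t : Triangle _
  t = toTriangle (adj G)
  G≈t : G ≈ᴳ fromTriangle t
  G≈t i j = sym (triangle-adj-toTriangle (adj G) (adj-sym G) (adj-irrefl G) i j)

-- A candidate isomorphism is any map p; its inverse is found by search and then checked.
preimage : ∀ {n} → (Fin n → Fin n) → Fin n → Fin n
preimage p y with any? (λ x → p x ≟ y)
... | yes (x , _) = x
... | no _ = y

IsoVia : ∀ {n} → Graph n → Graph n → (Fin n → Fin n) → Set
IsoVia G H p = (∀ i j → adj G i j ≡ adj H (p i) (p j))
             × (∀ x → preimage p (p x) ≡ x) × (∀ y → p (preimage p y) ≡ y)

IsoVia? : ∀ {n} (G H : Graph n) p → Dec (IsoVia G H p)
IsoVia? G H p = all? (λ i → all? (λ j → adj G i j Boolₚ.≟ adj H (p i) (p j)))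
         ×-dec all? (λ x → preimage p (p x) ≟ x) ×-dec all? (λ y → p (preimage p y) ≟ y)

isomorphism? : ∀ {n} (G H : Graph n) → Dec (∃ λ (p : Vec (Fin n) n) → IsoVia G H (lookup p))
isomorphism? G H = Vec-exhaustible any? (IsoVia? G H ∘ lookup)

IsoVia⇒≅ : ∀ {n} {G H : Graph n} → (∃ λ (p : Vec (Fin n) n) → IsoVia G H (lookup p)) → G ≅ H
IsoVia⇒≅ (p , preserves , left , right) = mk↔ₛ′ (lookup p) (preimage (lookup p)) right left , preserves

-- Opaque, so that these exhaustive checks are never unfolded when later goals are unified.
opaque
  2-regular-order-5⇒≅C₅ : (G : Graph 5) → (∀ v → deg G v ≡ 2) → G ≅ C₅
  2-regular-order-5⇒≅C₅ = by-triangles P resp λ t reg → IsoVia⇒≅ {G = fromTriangle t} {C₅} (checked t reg)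
    where
    P : Graph 5 → Set
    P G = (∀ v → deg G v ≡ 2) → G ≅ C₅
    resp : ∀ G H → G ≈ᴳ H → P H → P G
    resp G H G≈H PH reg =
      ≅-respˡ-≈ᴳ {G = G} {H} {C₅} G≈H (PH λ v → trans (sym (deg-resp-≈ᴳ {G = G} {H} G≈H v)) (reg v))
    checked : ∀ t → (∀ v → deg (fromTriangle t) v ≡ 2) → ∃ λ p → IsoVia (fromTriangle t) C₅ (lookup p)
    checked = toWitness {a? = ∀? Triangle-exhaustible λ t →
      all? (λ v → deg (fromTriangle t) v ℕ.≟ 2) →-dec isomorphism? (fromTriangle t) C₅} tt

  order-4-with-degree-3⇒K₄⊎K₄-e : (G : Graph 4) → (∃ λ v → deg G v ≡ 3) → (∀ v → deg G v ≢ 1) →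
                                  G ≅ K₄ ⊎ G ≅ K₄-e
  order-4-with-degree-3⇒K₄⊎K₄-e = by-triangles P resp λ t d3 ¬d1 →
    Sum.map (IsoVia⇒≅ {G = fromTriangle t} {K₄}) (IsoVia⇒≅ {G = fromTriangle t} {K₄-e}) (checked t d3 ¬d1)
    where
    P : Graph 4 → Set
    P G = (∃ λ v → deg G v ≡ 3) → (∀ v → deg G v ≢ 1) → G ≅ K₄ ⊎ G ≅ K₄-e
    resp : ∀ G H → G ≈ᴳ H → P H → P G
    resp G H G≈H PH (v , d3) ¬d1 =
      Sum.map (≅-respˡ-≈ᴳ {G = G} {H} {K₄} G≈H) (≅-respˡ-≈ᴳ {G = G} {H} {K₄-e} G≈H)
              (PH (v , trans (sym (deg-resp v)) d3) (λ w d1 → ¬d1 w (trans (deg-resp w) d1)))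
      where
      deg-resp : ∀ v → deg G v ≡ deg H v
      deg-resp = deg-resp-≈ᴳ {G = G} {H} G≈H
    checked : ∀ t → (∃ λ v → deg (fromTriangle t) v ≡ 3) → (∀ v → deg (fromTriangle t) v ≢ 1) →
              (∃ λ p → IsoVia (fromTriangle t) K₄ (lookup p)) ⊎ (∃ λ p → IsoVia (fromTriangle t) K₄-e (lookup p))
    checked = toWitness {a? = ∀? Triangle-exhaustible λ t →
      any? (λ v → deg (fromTriangle t) v ℕ.≟ 3) →-dec all? (λ v → ¬? (deg (fromTriangle t) v ℕ.≟ 1)) →-dec
      (isomorphism? (fromTriangle t) K₄ ⊎-dec isomorphism? (fromTriangle t) K₄-e)} tt

qtrdf-resp-≗ : ∀ {n} {G : Graph n} {f g : Fin n → ℕ} → (∀ x → f x ≡ g x) → IsQTRDF G f → IsQTRDF G g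
qtrdf-resp-≗ {G = G} {f} {g} f≗g q = record { range = range ; dom = dom ; quasi = quasi }
  where
  range : ∀ x → g x ≤ 2
  range x = subst (_≤ 2) (f≗g x) (IsQTRDF.range q x)
  dom : ∀ u → g u ≡ 0 → ∃ λ v → adj G u v ≡ true × g v ≡ 2
  dom u gu≡0 with IsQTRDF.dom q u (trans (f≗g u) gu≡0)
  ... | v , uv , fv≡2 = v , uv , trans (sym (f≗g v)) fv≡2
  quasi : ∀ x → 1 ≤ g x → (∀ y → adj G x y ≡ true → g y ≡ 0) → g x ≡ 1
  quasi x 1≤gx alone = trans (sym (f≗g x))
    (IsQTRDF.quasi q x (subst (1 ≤_) (sym (f≗g x)) 1≤gx) (λ y xy → trans (f≗g y) (alone y xy)))

IsQTRDF? : ∀ {n} (G : Graph n) f → Dec (IsQTRDF G f)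
IsQTRDF? G f = map′ (λ (range , dom , quasi) → record { range = range ; dom = dom ; quasi = quasi })
                    (λ q → IsQTRDF.range q , IsQTRDF.dom q , IsQTRDF.quasi q)
  (all? (λ x → f x ≤? 2)
   ×-dec all? (λ u → f u ℕ.≟ 0 →-dec any? (λ v → adj G u v Boolₚ.≟ true ×-dec f v ℕ.≟ 2))
   ×-dec all? (λ x → 1 ≤? f x →-dec
                     all? (λ y → adj G x y Boolₚ.≟ true →-dec f y ℕ.≟ 0) →-dec f x ℕ.≟ 1))

-- A QTRDF takes values in {0, 1, 2}, so it suffices to check the weight bound on all 3ⁿ such functions.
weight-bound-by-search : ∀ {n} (G : Graph n) k →
  (∀ (c : Vec (Fin 3) n) → IsQTRDF G (toℕ ∘ lookup c) → k ≤ sum (toℕ ∘ lookup c)) →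
  ∀ f → IsQTRDF G f → k ≤ sum f
weight-bound-by-search G k checked f q =
  subst (k ≤_) (sum-cong-≗ code≗f) (checked code (qtrdf-resp-≗ (sym ∘ code≗f) q))
  where
  code : Vec (Fin 3) _
  code = Vec.tabulate (λ x → fromℕ< (s≤s (IsQTRDF.range q x)))
  code≗f : ∀ x → toℕ (lookup code x) ≡ f x
  code≗f x = trans (cong toℕ (lookup∘tabulate _ x)) (toℕ-fromℕ< (s≤s (IsQTRDF.range q x)))

opaque
  C₅-weight≥5 : ∀ f → IsQTRDF C₅ f → 5 ≤ sum f
  C₅-weight≥5 = weight-bound-by-search C₅ 5 (toWitness {a? = ∀? (Vec-exhaustible any?) λ c →
    IsQTRDF? C₅ (toℕ ∘ lookup c) →-dec 5 ≤? sum (toℕ ∘ lookup c)} tt)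

  complement-C₅-weight≥5 : ∀ f → IsQTRDF (complement C₅) f → 5 ≤ sum f
  complement-C₅-weight≥5 = weight-bound-by-search (complement C₅) 5 (toWitness {a? = ∀? (Vec-exhaustible any?) λ c →
    IsQTRDF? (complement C₅) (toℕ ∘ lookup c) →-dec 5 ≤? sum (toℕ ∘ lookup c)} tt)

-- The families attaining the lower bound

In𝓕₁-resp-≈ᴳ : ∀ {n} {G H : Graph n} → G ≈ᴳ H → In𝓕₁ H → In𝓕₁ G
In𝓕₁-resp-≈ᴳ {G = G} {H} G≈H ((v , deg-v , unique) , u , deg-u) =
  (v , trans (deg-resp v) deg-v , λ w deg-w → unique w (trans (sym (deg-resp w)) deg-w))
  , u , trans (deg-resp u) deg-u
  where
  deg-resp : ∀ v → deg G v ≡ deg H v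
  deg-resp = deg-resp-≈ᴳ {G = G} {H} G≈H

InFamily-resp-≈ᴳ : ∀ {n} {G H : Graph n} → G ≈ᴳ H → InFamily H → InFamily G
InFamily-resp-≈ᴳ {G = G} {H} G≈H = Sum.map (resp K₄) (Sum.map (resp (complement K₄))
  (Sum.map (resp K₄-e) (Sum.map (resp (complement K₄-e))
  (Sum.map (In𝓕₁-resp-≈ᴳ {G = G} {H} G≈H) λ (K , F , H≅K̄) → K , F , resp (complement K) H≅K̄))))
  where
  resp : ∀ {m} (K : Graph m) → H ≅ K → G ≅ K
  resp K = ≅-respˡ-≈ᴳ {G = G} {H} {K} G≈H

𝓕₁-pair : ∀ {n} {G : Graph n} → In𝓕₁ G → InFamily G × InFamily (complement G)
𝓕₁-pair {G = G} F =
  inj₂ (inj₂ (inj₂ (inj₂ (inj₁ F)))) , inj₂ (inj₂ (inj₂ (inj₂ (inj₂ (G , F , ≅-refl {G = complement G})))))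

𝓕₁-intro : ∀ {n} {G : Graph n} {v z} → 4 ≤ n → Dominating G v → z ≢ v →
           (∀ x → adj G z x ≡ true → x ≡ v) → In𝓕₁ G
𝓕₁-intro {n} {G} {v} {z} 4≤n dom z≢v only = (v , deg-v , unique) , z , deg-z
  where
  1≤n : 1 ≤ n
  1≤n = ≤-trans (s≤s z≤n) 4≤n
  deg-v : deg G v ≡ n ∸ 1
  deg-v = trans (sym (m+n∸n≡m (deg G v) 1)) (cong (_∸ 1) (dominating⇒deg G dom))
  neighbours-of-z : ∀ x → 𝟙 (adj G z x) ≡ δ v x
  neighbours-of-z x with toSum (x ≟ v)
  ... | inj₁ refl = trans (cong 𝟙 (trans (adj-sym G z x) (dom z z≢v))) (sym (δ-self x))
  ... | inj₂ x≢v = trans (cong 𝟙 (Boolₚ.¬-not (x≢v ∘ only x))) (sym (δ-other x≢v))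
  deg-z : deg G z ≡ 1
  deg-z = trans (deg≡sum G z) (trans (sum-cong-≗ neighbours-of-z) (sum-δ v))
  unique : ∀ w → deg G w ≡ n ∸ 1 → w ≡ v
  unique w deg-w = decidable-stable (w ≟ v) λ w≢v →
    w≢v (only w (trans (adj-sym G z w) (deg≡n∸1⇒dominating G 1≤n deg-w z z≢w)))
    where
    z≢w : z ≢ w
    z≢w refl = contradiction (subst (3 ≤_) (trans (sym deg-w) deg-z) (∸-monoˡ-≤ 1 4≤n)) λ { (s≤s ()) }

𝓕₁⇒sum≤7 : ∀ {n} {G : Graph n} {a b} → 4 ≤ n → In𝓕₁ G → IsγqtR G a → IsγqtR (complement G) b →
           a + b ≤ 7
𝓕₁⇒sum≤7 {n} {G} {a} {b} 4≤n ((v , deg-v , _) , z , deg-z) γa γb =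
  +-mono-≤ (γ≤3-of-dominating 2≤n γa (deg≡n∸1⇒dominating G (<⇒≤ 2≤n) deg-v)) b≤4
  where
  2≤n : 2 ≤ n
  2≤n = <⇒≤ (<⇒≤ 4≤n)
  b≤4 : b ≤ 4
  b≤4 with isolated⊎neighbour (complement G) z
  ... | inj₁ iso = contradiction (subst (4 ≤_) n≡2 4≤n) λ { (s≤s (s≤s ())) }
    where
    n≡2 : n ≡ 2
    n≡2 = trans (sym (dominating⇒deg G (isolated-complement⇒dominating G iso))) (cong (_+ 1) deg-z)
  ... | inj₂ (y , zy) = +-cancelʳ-≤ (deg (complement G) z) b 4 (begin
    b + deg (complement G) z                ≤⟨ γ+deg≤n+2 γb zy ⟩
    n + 2                                   ≡⟨ cong (_+ 2) (deg-complement G z) ⟨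
    deg G z + deg (complement G) z + 1 + 2  ≡⟨ cong (λ d → d + deg (complement G) z + 1 + 2) deg-z ⟩
    1 + deg (complement G) z + 1 + 2        ≡⟨ identity (deg (complement G) z) ⟩
    4 + deg (complement G) z                ∎)
    where
    open ≤-Reasoning
    identity : ∀ d → 1 + d + 1 + 2 ≡ 4 + d
    identity = solve-∀

Dominating? : ∀ {n} (G : Graph n) v → Dec (Dominating G v)
Dominating? G v = all? (λ x → ¬? (x ≟ v) →-dec adj G v x Boolₚ.≟ true)

Isolated? : ∀ {n} (G : Graph n) v → Dec (Isolated G v)
Isolated? G v = all? (λ x → adj G v x Boolₚ.≟ false)

extreme-vertex-by-check : (X : Graph 4) {checked : True (Dominating? X 1F ⊎-dec Isolated? X 1F)} →
                          Dominating X 1F ⊎ Isolated X 1F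
extreme-vertex-by-check X {checked} = toWitness checked

≅-order-4⇒sum≤7 : ∀ {n} {G : Graph n} {a b} (X : Graph 4) → Dominating X 1F ⊎ Isolated X 1F →
                  G ≅ X → IsγqtR G a → IsγqtR (complement G) b → a + b ≤ 7
≅-order-4⇒sum≤7 {G = G} X extreme iso γa γb =
  NordhausGaddum.extreme-vertex⇒sum≤n+3 ≤-refl (γ-≅ {G = G} {X} iso γa)
    (γ-≅ {G = complement G} {complement X} (≅-complement {G = G} {X} iso) γb) extreme

family⇒sum≤7 : ∀ {n} {G : Graph n} {a b} → 4 ≤ n → InFamily G → IsγqtR G a → IsγqtR (complement G) b →
               a + b ≤ 7
family⇒sum≤7 _ (inj₁ iso) = ≅-order-4⇒sum≤7 K₄ (extreme-vertex-by-check K₄) iso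
family⇒sum≤7 _ (inj₂ (inj₁ iso)) = ≅-order-4⇒sum≤7 (complement K₄) (extreme-vertex-by-check (complement K₄)) iso
family⇒sum≤7 _ (inj₂ (inj₂ (inj₁ iso))) = ≅-order-4⇒sum≤7 K₄-e (extreme-vertex-by-check K₄-e) iso
family⇒sum≤7 _ (inj₂ (inj₂ (inj₂ (inj₁ iso)))) =
  ≅-order-4⇒sum≤7 (complement K₄-e) (extreme-vertex-by-check (complement K₄-e)) iso
family⇒sum≤7 4≤n (inj₂ (inj₂ (inj₂ (inj₂ (inj₁ F))))) = 𝓕₁⇒sum≤7 4≤n F
family⇒sum≤7 {G = G} {a} {b} 4≤n (inj₂ (inj₂ (inj₂ (inj₂ (inj₂ (H , F , iso)))))) γa γb =
  subst (_≤ 7) (+-comm b a) (𝓕₁⇒sum≤7 4≤n F γH γH̄)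
  where
  γH̄ : IsγqtR (complement H) a
  γH̄ = γ-≅ {G = G} {complement H} iso γa
  γH : IsγqtR H b
  γH = γ-≅ {G = complement (complement H)} {H} (≈ᴳ⇒≅ {G = complement (complement H)} {H} (complement-involutive H))
             (γ-≅ {G = complement G} {complement (complement H)} (≅-complement {G = G} {complement H} iso) γb)

order-4⇒family : ∀ {n} → n ≡ 4 → (G : Graph n) {v : Fin n} → Dominating G v →
                 InFamily G × InFamily (complement G)
order-4⇒family refl G {v} dom with any? (λ z → deg G z ℕ.≟ 1)
... | yes (z , deg-z) = 𝓕₁-pair {G = G} (𝓕₁-intro {G = G} ≤-refl dom z≢v only)
  where
  z≢v : z ≢ v
  z≢v refl = contradiction (trans (cong (_+ 1) (sym deg-z)) (dominating⇒deg G dom)) λ ()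
  only : ∀ x → adj G z x ≡ true → x ≡ v
  only x zx = decidable-stable (x ≟ v) λ x≢v →
    contradiction (subst (2 ≤_) deg-z (two-neighbours⇒2≤deg G zx (trans (adj-sym G z v) (dom z z≢v)) x≢v))
                  λ { (s≤s ()) }
... | no ¬deg-1 with order-4-with-degree-3⇒K₄⊎K₄-e G (v , +-cancelʳ-≡ 1 _ 3 (dominating⇒deg G dom))
                                                      (λ w deg-w → ¬deg-1 (w , deg-w))
...   | inj₁ iso = inj₁ iso , inj₂ (inj₁ (≅-complement {G = G} {K₄} iso))
...   | inj₂ iso = inj₂ (inj₂ (inj₁ iso)) , inj₂ (inj₂ (inj₂ (inj₁ (≅-complement {G = G} {K₄-e} iso))))

γ≡3×γ-complement≡4⇒family : ∀ {n} {G : Graph n} → 4 ≤ n → IsγqtR G 3 → IsγqtR (complement G) 4 →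
                            InFamily G × InFamily (complement G)
γ≡3×γ-complement≡4⇒family {n} {G} 4≤n γ3 γ4 with γ-attained γ3 | γ-attained γ4
... | f , qf , wf | g , qg , wg with weight≡3⇒dominating 4≤n qf wf | qtrdf-shape qg
...   | v , dom | inj₁ positive = order-4⇒family (≤-antisym (subst (n ≤_) wg (positive⇒n≤sum positive)) 4≤n) G dom
...   | v , dom | inj₂ (z , y , gz≡2 , zy , 1≤gy) = 𝓕₁-pair {G = G} (𝓕₁-intro {G = G} 4≤n dom z≢v only)
  where
  Ḡ : Graph n
  Ḡ = complement G
  iso : Isolated Ḡ v
  iso = dominating⇒isolated-complement G dom
  z≢v : z ≢ v
  z≢v = proj₁ (isolated∉edge Ḡ iso zy) ∘ sym
  only : ∀ x → adj G z x ≡ true → x ≡ v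
  only x zx = decidable-stable (x ≟ v) λ x≢v → false≢true (trans (sym (adj⇒¬adj-complement G zx))
    (weight≡4⇒almost-dominating iso qg wg gz≡2 zy 1≤gy x x≢v (adj⇒≢ G zx ∘ sym)))

three-or-four : ∀ {a b} → 3 ≤ a → 3 ≤ b → a + b ≡ 7 → a ≡ 3 × b ≡ 4 ⊎ a ≡ 4 × b ≡ 3
three-or-four {0} () _ _
three-or-four {1} (s≤s ()) _ _
three-or-four {2} (s≤s (s≤s ())) _ _
three-or-four {3} _ _ refl = inj₁ (refl , refl)
three-or-four {4} _ _ refl = inj₂ (refl , refl)
three-or-four {suc (suc (suc (suc (suc a))))} {b} _ 3≤b a+b≡7 =
  contradiction (≤-trans 3≤b (subst (b ≤_) (+-cancelˡ-≡ 5 (a + b) 2 a+b≡7) (m≤n+m b a))) λ { (s≤s (s≤s ())) }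

sum≡7⇒family : ∀ {n} {G : Graph n} {a b} → 4 ≤ n → IsγqtR G a → IsγqtR (complement G) b → a + b ≡ 7 →
               InFamily G × InFamily (complement G)
sum≡7⇒family {G = G} 4≤n γa γb a+b≡7 with three-or-four (3≤γ (<⇒≤ 4≤n) γa) (3≤γ (<⇒≤ 4≤n) γb) a+b≡7
... | inj₁ (refl , refl) = γ≡3×γ-complement≡4⇒family 4≤n γa γb
... | inj₂ (refl , refl) =
  let FḠ , FḠ̄ = γ≡3×γ-complement≡4⇒family 4≤n γb
                   (γ-≅ (≈ᴳ⇒≅ {G = G} {complement (complement G)} (≈ᴳ-complement² G)) γa)
  in InFamily-resp-≈ᴳ {G = G} {complement (complement G)} (≈ᴳ-complement² G) FḠ̄ , FḠ

-- The cycle C₅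

≅C₅⇒sum≡n+5 : ∀ {n} {G : Graph n} {a b} → 4 ≤ n → IsγqtR G a → IsγqtR (complement G) b → G ≅ C₅ →
              a + b ≡ n + 5
≅C₅⇒sum≡n+5 {n} {G} {a} {b} 4≤n γa γb iso = ≤-antisym (NordhausGaddum.sum≤n+5 4≤n γa γb)
  (subst (λ m → m + 5 ≤ a + b) (sym (↔⇒≡ (proj₁ iso)))
    (+-mono-≤ (≤γ C₅-weight≥5 (γ-≅ {G = G} {C₅} iso γa))
              (≤γ complement-C₅-weight≥5 (γ-≅ {G = complement G} {complement C₅} (≅-complement {G = G} {C₅} iso) γb))))

2-regular⇒≅C₅ : ∀ {n} → n ≡ 5 → (G : Graph n) → (∀ v → deg G v ≡ 2) → G ≅ C₅
2-regular⇒≅C₅ refl = 2-regular-order-5⇒≅C₅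

mainTheorem10 : (n : ℕ) → 4 ≤ n → (G : Graph n) → (a b : ℕ) →
    IsγqtR G a → IsγqtR (complement G) b →
    (7 ≤ a + b) × (a + b ≤ n + 5)
    × ((a + b ≡ 7) ⇔ (InFamily G × InFamily (complement G)))
    × ((a + b ≡ n + 5) ⇔ (G ≅ C₅))
mainTheorem10 n 4≤n G a b γa γb =
    7≤sum
  , sum≤n+5
  , mk⇔ (sum≡7⇒family 4≤n γa γb) (λ (FG , _) → ≤-antisym (family⇒sum≤7 4≤n FG γa γb) 7≤sum)
  , mk⇔ extremal (≅C₅⇒sum≡n+5 4≤n γa γb)
  where
  open NordhausGaddum 4≤n γa γb
  extremal : a + b ≡ n + 5 → G ≅ C₅
  extremal a+b≡n+5 =
    let n≡5 , 2-regular = Extremal.order-5-and-2-regular a+b≡n+5 in 2-regular⇒≅C₅ n≡5 G 2-regular
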